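{- Let $w\ge1$ and $a,b,r$ be integers with $0\le a,b,r<w$. Consider the $\texttt{xoshiro++}$ generator with $w$ bits of output and $8w$ bits of state: state $(s_0,\dots,s_7)$ of $w$-bit words, next-state map \[ \begin{aligned} s'_0&=s_0\oplus s_6, & s'_1&=s_0\oplus s_1\oplus s_2, & s'_2&=s_0\oplus s_2, & s'_3&=s_3\oplus s_4,\\ s'_4&=s_1\oplus s_4\oplus s_5, & s'_5&=s_1\oplus s_5, & s'_6&=s_3\oplus s_6\oplus s_7\oplus(s_1\ll a), & s'_7&=\mathrm{rotl}(s_3\oplus s_7,b), \end{aligned} \] and output $\mathrm{rotl}(s_2+s_0,r)+s_2$ (the $\texttt{++}$ scrambler on the third and first words of state). Then this generator is $7$-dimensionally equidistributed.
   Context: A $w$-bit word is an element of $\{0,1\}^w$, identified with an integer in $[0,2^w)$. $\oplus$ is bitwise xor, $x\ll a$ is $x\cdot 2^a\bmod 2^w$, $\mathrm{rotl}(x,r)$ is left rotation by $r$ positions, and $+$ between words is addition in $\mathbf Z/2^w\mathbf Z$. A generator with $kw$ bits of state (here $k=8$), next-state map $T$ and $w$-bit output function $\varphi$ is $d$-dimensionally equidistributed ($d\le k$) if, as $s$ ranges over all nonzero states, every $d$-tuple $(\varphi(s),\varphi(Ts),\dots,\varphi(T^{d-1}s))$ appears exactly $2^{w(k-d)}$ times, except the all-zero $d$-tuple, which appears $2^{w(k-d)}-1$ times. -}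

module Defs where

open import Data.Bool using (Bool; true; false; _xor_)
import Data.Bool as B
open import Data.Nat using (ℕ; zero; suc; _+_; _*_; _∸_; _^_; _≡ᵇ_)
open import Data.Nat.DivMod using (_/_; _%_)
open import Data.Fin using (Fin; toℕ)
open import Data.Vec using (Vec; []; _∷_; zipWith; tabulate; replicate)
import Data.Vec.Properties as VP
open import Data.Nat.Properties using (m^n≢0)
open import Data.List using (List; []; _∷_; map; concatMap; filter; length)
open import Data.Product using (_×_; _,_)
open import Relation.Binary.PropositionalEquality using (_≡_)
open import Relation.Binary.Definitions using (DecidableEquality)
open import Relation.Nullary using (¬?; ¬_)
open import Relation.Nullary.Decidable using (_×-dec_)

-- w-bit words: vectors of w bits, little-endian (head = least significant bit)

Word : ℕ → Set
Word w = Vec Bool w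

val : ∀ {w} → Word w → ℕ
val []       = 0
val (b ∷ bs) = (if b then 1 else 0) + 2 * val bs
  where open B using (if_then_else_)

fromNat : (w : ℕ) → ℕ → Word w
fromNat zero    n = []
fromNat (suc w) n = (n % 2 ≡ᵇ 1) ∷ fromNat w (n / 2)

_≟W_ : ∀ {w} → DecidableEquality (Word w)
_≟W_ = VP.≡-dec B._≟_

zeroW : ∀ {w} → Word w
zeroW = replicate _ false

infixl 6 _⊕_
infixl 5 _⊞_
_⊕_ : ∀ {w} → Word w → Word w → Word w
_⊕_ = zipWith _xor_

_⊞_ : ∀ {w} → Word w → Word w → Word w
_⊞_ {w} x y = fromNat w (val x + val y)

shl : ∀ {w} → Word w → ℕ → Word w
shl {w} x a = fromNat w (val x * 2 ^ a)

-- left rotation by r positions (intended for 0 ≤ r < w):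
-- (x·2^r mod 2^w) + ⌊x / 2^(w−r)⌋, the two parts having disjoint bits
rotl : ∀ {w} → Word w → ℕ → Word w
rotl {w} x r = fromNat w (val x * 2 ^ r + _/_ (val x) (2 ^ (w ∸ r)) {{m^n≢0 2 (w ∸ r)}})

allVecs : ∀ {A : Set} → List A → (n : ℕ) → List (Vec A n)
allVecs xs zero    = [] ∷ []
allVecs xs (suc n) = concatMap (λ x → map (x ∷_) (allVecs xs n)) xs

allWords : (w : ℕ) → List (Word w)
allWords w = allVecs (true ∷ false ∷ []) w

State : ℕ → ℕ → Set
State k w = Vec (Word w) k

allStates : (k w : ℕ) → List (State k w)
allStates k w = allVecs (allWords w) k

_≟V_ : ∀ {n w} → DecidableEquality (Vec (Word w) n)
_≟V_ = VP.≡-dec _≟W_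

zeroV : ∀ {n w} → Vec (Word w) n
zeroV = replicate _ zeroW

iterate : ∀ {A : Set} → (A → A) → ℕ → A → A
iterate f zero    x = x
iterate f (suc n) x = f (iterate f n x)

outTuple : ∀ {k w} → (State k w → State k w) → (State k w → Word w) →
           (d : ℕ) → State k w → Vec (Word w) d
outTuple T φ d s = tabulate (λ i → φ (iterate T (toℕ i) s))

count : ∀ {k w} → (State k w → State k w) → (State k w → Word w) →
        (d : ℕ) → Vec (Word w) d → ℕ
count {k} {w} T φ d t =
  length (filter (λ s → ¬? (s ≟V zeroV) ×-dec (outTuple T φ d s ≟V t))
                 (allStates k w))

Equidistributed : (k w : ℕ) → (State k w → State k w) → (State k w → Word w) →
                  ℕ → Set
Equidistributed k w T φ d =
  (t : Vec (Word w) d) →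
    (t ≡ zeroV → count T φ d t ≡ 2 ^ (w * (k ∸ d)) ∸ 1) ×
    (¬ (t ≡ zeroV) → count T φ d t ≡ 2 ^ (w * (k ∸ d)))

next : (w a b : ℕ) → State 8 w → State 8 w
next w a b (s0 ∷ s1 ∷ s2 ∷ s3 ∷ s4 ∷ s5 ∷ s6 ∷ s7 ∷ []) =
    (s0 ⊕ s6)
  ∷ (s0 ⊕ s1 ⊕ s2)
  ∷ (s0 ⊕ s2)
  ∷ (s3 ⊕ s4)
  ∷ (s1 ⊕ s4 ⊕ s5)
  ∷ (s1 ⊕ s5)
  ∷ (s3 ⊕ s6 ⊕ s7 ⊕ shl s1 a)
  ∷ rotl (s3 ⊕ s7) b
  ∷ []

output : (w r : ℕ) → State 8 w → Word w
output w r (s0 ∷ s1 ∷ s2 ∷ s3 ∷ s4 ∷ s5 ∷ s6 ∷ s7 ∷ []) =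
  rotl (s2 ⊞ s0) r ⊞ s2

-- Fix the outputs t and the initial value c of s₂. The ++ scrambler is invertible once its carry s₂
-- is known, and s₂ evolves by s₂ ← s₀ ⊕ s₂, so t and c determine the first seven values y₀ … y₆ of
-- s₀. The xorshift part makes s ↦ (s₂, y₀, …, y₆) linear over GF(2) in the operators x ≪ a and
-- rotl(x, b), and it is invertible: an explicit inverse is checked by computing in the free module
-- over the free algebra on these two operators. So every 7-tuple of outputs comes from exactly 2^w
-- states (one for each c), and discarding the all-zero state, whose outputs vanish, gives the counts.
module Submission where

open import Defs
open import Data.Bool using (Bool; true; false; _xor_)
import Data.Bool
open import Data.Bool.Properties using (xor-assoc; xor-comm; xor-identityʳ; xor-same)
open import Data.Empty using (⊥-elim)
open import Data.Fin using (Fin; zero; suc; toℕ; fromℕ<; #_)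
import Data.Fin.Properties as Fin
open import Data.List
  using (List; []; _∷_; foldr; length; filter; concatMap; _++_) renaming (map to mapᴸ)
import Data.List.Properties as List
open import Data.Nat
  using (ℕ; zero; suc; _+_; _*_; _∸_; _^_; _≡ᵇ_; _≤_; _<_; z≤n; s≤s; NonZero)
open import Data.Nat.DivMod
open import Data.Nat.Divisibility using (n∣m*n)
open import Data.Nat.ListAction using (sum)
open import Data.Nat.Properties
open import Data.Nat.Solver using (module +-*-Solver)
open import Data.Product using (∃; _×_; _,_; proj₁; proj₂; map₁)
import Data.Product.Properties as Product
open import Data.Sum using (_⊎_; inj₁; inj₂)
open import Data.Vec using (Vec; []; _∷_; head; tail; lookup; map; tabulate; zipWith; replicate)
open import Data.Vec.Properties
  using (zipWith-assoc; zipWith-comm; zipWith-identityʳ; ∷-injective; lookup-map; lookup-replicate;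
         map-∘; map-cong; tabulate-∘; tabulate-cong; tabulate∘lookup)
open import Function using (case_of_)
open import Level using (0ℓ)
open import Relation.Binary.Definitions using (DecidableEquality)
open import Relation.Binary.PropositionalEquality hiding ([_])
open import Relation.Nullary using (Dec; yes; no; does; ¬_; ¬?)
open import Relation.Nullary.Decidable using (True; _×-dec_; dec-true; dec-false)
open import Relation.Unary using (Pred; Decidable; _≐_)

⊕-assoc : ∀ {w} (x y z : Word w) → (x ⊕ y) ⊕ z ≡ x ⊕ (y ⊕ z)
⊕-assoc = zipWith-assoc xor-assoc

⊕-comm : ∀ {w} (x y : Word w) → x ⊕ y ≡ y ⊕ x
⊕-comm = zipWith-comm xor-comm

⊕-identityʳ : ∀ {w} (x : Word w) → x ⊕ zeroW ≡ x
⊕-identityʳ = zipWith-identityʳ xor-identityʳ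

⊕-identityˡ : ∀ {w} (x : Word w) → zeroW ⊕ x ≡ x
⊕-identityˡ x = trans (⊕-comm zeroW x) (⊕-identityʳ x)

⊕-self : ∀ {w} (x : Word w) → x ⊕ x ≡ zeroW
⊕-self []       = refl
⊕-self (b ∷ x) = cong₂ _∷_ (xor-same b) (⊕-self x)

⊕-cancelˡ : ∀ {w} (x y : Word w) → x ⊕ (x ⊕ y) ≡ y
⊕-cancelˡ x y = begin
  x ⊕ (x ⊕ y) ≡⟨ ⊕-assoc x x y ⟨
  x ⊕ x ⊕ y   ≡⟨ cong (_⊕ y) (⊕-self x) ⟩
  zeroW ⊕ y   ≡⟨ ⊕-identityˡ y ⟩
  y           ∎
  where open ≡-Reasoning

⊕-swap : ∀ {w} (x y z : Word w) → x ⊕ (y ⊕ z) ≡ y ⊕ (x ⊕ z)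
⊕-swap x y z = begin
  x ⊕ (y ⊕ z) ≡⟨ ⊕-assoc x y z ⟨
  x ⊕ y ⊕ z   ≡⟨ cong (_⊕ z) (⊕-comm x y) ⟩
  y ⊕ x ⊕ z   ≡⟨ ⊕-assoc y x z ⟩
  y ⊕ (x ⊕ z) ∎
  where open ≡-Reasoning

⊕≡zero⇒≡ : ∀ {w} (x y : Word w) → x ⊕ y ≡ zeroW → x ≡ y
⊕≡zero⇒≡ x y x⊕y≡0 = begin
  x               ≡⟨ ⊕-identityʳ x ⟨
  x ⊕ zeroW       ≡⟨ cong (x ⊕_) (⊕-self y) ⟨
  x ⊕ (y ⊕ y)     ≡⟨ ⊕-assoc x y y ⟨
  x ⊕ y ⊕ y       ≡⟨ cong (_⊕ y) x⊕y≡0 ⟩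
  zeroW ⊕ y       ≡⟨ ⊕-identityˡ y ⟩
  y               ∎
  where open ≡-Reasoning

bitValue : Bool → ℕ
bitValue false = 0
bitValue true  = 1

testBitℕ : ℕ → ℕ → Bool
testBitℕ n zero    = n % 2 ≡ᵇ 1
testBitℕ n (suc k) = testBitℕ (n / 2) k

testBit : ∀ {w} → Word w → ℕ → Bool
testBit []      k       = false
testBit (b ∷ x) zero    = b
testBit (b ∷ x) (suc k) = testBit x k

val-∷ : ∀ {w} b (x : Word w) → val (b ∷ x) ≡ bitValue b + 2 * val x
val-∷ false x = refl
val-∷ true  x = refl

val<2^w : ∀ {w} (x : Word w) → val x < 2 ^ w
val<2^w [] = s≤s z≤n
val<2^w {suc w} (b ∷ x) rewrite val-∷ b x = begin-strict
  bitValue b + 2 * val x ≤⟨ +-monoˡ-≤ (2 * val x) (bitValue≤1 b) ⟩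
  1 + 2 * val x          <⟨ +-monoˡ-< (2 * val x) (n<1+n 1) ⟩
  2 + 2 * val x          ≡⟨ *-suc 2 (val x) ⟨
  2 * suc (val x)        ≤⟨ *-monoʳ-≤ 2 (val<2^w x) ⟩
  2 * 2 ^ w              ∎
  where
  open ≤-Reasoning
  bitValue≤1 : ∀ b → bitValue b ≤ 1
  bitValue≤1 false = z≤n
  bitValue≤1 true  = s≤s z≤n

val-zeroW : ∀ w → val (zeroW {w}) ≡ 0
val-zeroW zero    = refl
val-zeroW (suc w) = cong (2 *_) (val-zeroW w)

fromNat-0 : ∀ w → fromNat w 0 ≡ zeroW
fromNat-0 zero    = refl
fromNat-0 (suc w) = cong (false ∷_) (fromNat-0 w)

bitValue+2*-%2 : ∀ b n → (bitValue b + 2 * n) % 2 ≡ bitValue b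
bitValue+2*-%2 b n = begin
  (bitValue b + 2 * n) % 2 ≡⟨ cong (λ m → (bitValue b + m) % 2) (*-comm 2 n) ⟩
  (bitValue b + n * 2) % 2 ≡⟨ [m+kn]%n≡m%n (bitValue b) n 2 ⟩
  bitValue b % 2           ≡⟨ m<n⇒m%n≡m (bitValue<2 b) ⟩
  bitValue b               ∎
  where
  open ≡-Reasoning
  bitValue<2 : ∀ b → bitValue b < 2
  bitValue<2 false = s≤s z≤n
  bitValue<2 true  = s≤s (s≤s z≤n)

bitValue+2*-/2 : ∀ b n → (bitValue b + 2 * n) / 2 ≡ n
bitValue+2*-/2 false n = trans (cong (_/ 2) (*-comm 2 n)) (m*n/n≡m n 2)
bitValue+2*-/2 true  n = begin
  (1 + 2 * n) / 2   ≡⟨ cong (λ m → (1 + m) / 2) (*-comm 2 n) ⟩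
  (1 + n * 2) / 2   ≡⟨ +-distrib-/-∣ʳ 1 {d = 2} (n∣m*n n) ⟩
  0 + n * 2 / 2     ≡⟨ m*n/n≡m n 2 ⟩
  n                 ∎
  where open ≡-Reasoning

bitValue-≡ᵇ1 : ∀ b → (bitValue b ≡ᵇ 1) ≡ b
bitValue-≡ᵇ1 false = refl
bitValue-≡ᵇ1 true  = refl

testBitℕ-val : ∀ {w} (x : Word w) k → testBitℕ (val x) k ≡ testBit x k
testBitℕ-val []      zero    = refl
testBitℕ-val []      (suc k) = testBitℕ-val [] k
testBitℕ-val (b ∷ x) zero    rewrite val-∷ b x | bitValue+2*-%2 b (val x) = bitValue-≡ᵇ1 b
testBitℕ-val (b ∷ x) (suc k) rewrite val-∷ b x | bitValue+2*-/2 b (val x) = testBitℕ-val x k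

testBit-fromNat : ∀ w n k → k < w → testBit (fromNat w n) k ≡ testBitℕ n k
testBit-fromNat (suc w) n zero    _         = refl
testBit-fromNat (suc w) n (suc k) (s≤s k<w) = testBit-fromNat w (n / 2) k k<w

testBit-⊕ : ∀ {w} (x y : Word w) k → testBit (x ⊕ y) k ≡ testBit x k xor testBit y k
testBit-⊕ []      []      k       = refl
testBit-⊕ (b ∷ x) (c ∷ y) zero    = refl
testBit-⊕ (b ∷ x) (c ∷ y) (suc k) = testBit-⊕ x y k

word-ext : ∀ {w} (x y : Word w) → (∀ k → k < w → testBit x k ≡ testBit y k) → x ≡ y
word-ext []      []      _    = refl
word-ext (b ∷ x) (c ∷ y) same =
  cong₂ _∷_ (same 0 (s≤s z≤n)) (word-ext x y (λ k k<w → same (suc k) (s≤s k<w)))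

fromNat-val : ∀ {w} (x : Word w) → fromNat w (val x) ≡ x
fromNat-val {w} x = word-ext _ _ λ k k<w →
  trans (testBit-fromNat w (val x) k k<w) (testBitℕ-val x k)

_/2^_ : ℕ → ℕ → ℕ
n /2^ j = _/_ n (2 ^ j) {{m^n≢0 2 j}}

m*2^suc : ∀ m j → m * 2 ^ suc j ≡ m * 2 ^ j * 2
m*2^suc m j = trans (cong (m *_) (*-comm 2 (2 ^ j))) (sym (*-assoc m (2 ^ j) 2))

testBitℕ-/2^ : ∀ n j k → testBitℕ (n /2^ j) k ≡ testBitℕ n (j + k)
testBitℕ-/2^ n zero    k = cong (λ m → testBitℕ m k) (n/1≡n n)
testBitℕ-/2^ n (suc j) k = begin
  testBitℕ (n /2^ suc j) k     ≡⟨ cong (λ m → testBitℕ m k) halve-first ⟩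
  testBitℕ ((n / 2) /2^ j) k   ≡⟨ testBitℕ-/2^ (n / 2) j k ⟩
  testBitℕ n (suc j + k)       ∎
  where
  open ≡-Reasoning
  halve-first : n /2^ suc j ≡ (n / 2) /2^ j
  halve-first = sym (m/n/o≡m/[n*o] n 2 (2 ^ j) {{_}} {{m^n≢0 2 j}} {{m^n≢0 2 (suc j)}})

testBitℕ-low : ∀ n m j k → k < j → testBitℕ (n + m * 2 ^ j) k ≡ testBitℕ n k
testBitℕ-low n m (suc j) zero    _ =
  cong (_≡ᵇ 1) (trans (cong (λ p → (n + p) % 2) (m*2^suc m j)) ([m+kn]%n≡m%n n (m * 2 ^ j) 2))
testBitℕ-low n m (suc j) (suc k) (s≤s k<j) =
  trans (cong (λ p → testBitℕ p k) halve) (testBitℕ-low (n / 2) m j k k<j)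
  where
  open ≡-Reasoning
  halve : (n + m * 2 ^ suc j) / 2 ≡ n / 2 + m * 2 ^ j
  halve = begin
    (n + m * 2 ^ suc j) / 2     ≡⟨ cong (λ p → (n + p) / 2) (m*2^suc m j) ⟩
    (n + m * 2 ^ j * 2) / 2     ≡⟨ +-distrib-/-∣ʳ n (n∣m*n (m * 2 ^ j)) ⟩
    n / 2 + m * 2 ^ j * 2 / 2   ≡⟨ cong (n / 2 +_) (m*n/n≡m (m * 2 ^ j) 2) ⟩
    n / 2 + m * 2 ^ j           ∎

testBitℕ-high : ∀ n m j k → n < 2 ^ j → testBitℕ (n + m * 2 ^ j) (j + k) ≡ testBitℕ m k
testBitℕ-high n m j k n<2^j = begin
  testBitℕ (n + m * 2 ^ j) (j + k)       ≡⟨ testBitℕ-/2^ (n + m * 2 ^ j) j k ⟨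
  testBitℕ ((n + m * 2 ^ j) /2^ j) k     ≡⟨ cong (λ p → testBitℕ p k) drop-low ⟩
  testBitℕ m k                           ∎
  where
  open ≡-Reasoning
  instance
    2^j-nonZero : NonZero (2 ^ j)
    2^j-nonZero = m^n≢0 2 j
  drop-low : (n + m * 2 ^ j) / 2 ^ j ≡ m
  drop-low = begin
    (n + m * 2 ^ j) / 2 ^ j             ≡⟨ +-distrib-/-∣ʳ n (n∣m*n m) ⟩
    n / 2 ^ j + m * 2 ^ j / 2 ^ j       ≡⟨ cong₂ _+_ (m<n⇒m/n≡0 n<2^j) (m*n/n≡m m (2 ^ j)) ⟩
    m                                   ∎

testBitℕ-0 : ∀ k → testBitℕ 0 k ≡ false
testBitℕ-0 zero    = refl
testBitℕ-0 (suc k) = testBitℕ-0 k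

Xor-linear : ∀ {w} → (Word w → Word w) → Set
Xor-linear f = ∀ x y → f (x ⊕ y) ≡ f x ⊕ f y

xor-linear⇒zero : ∀ {w} {f : Word w → Word w} → Xor-linear f → f zeroW ≡ zeroW
xor-linear⇒zero {f = f} lin = begin
  f zeroW                      ≡⟨ ⊕-cancelˡ (f zeroW) (f zeroW) ⟨
  f zeroW ⊕ (f zeroW ⊕ f zeroW) ≡⟨ cong (f zeroW ⊕_) (lin zeroW zeroW) ⟨
  f zeroW ⊕ f (zeroW ⊕ zeroW)   ≡⟨ cong (λ z → f zeroW ⊕ f z) (⊕-self zeroW) ⟩
  f zeroW ⊕ f zeroW             ≡⟨ ⊕-self (f zeroW) ⟩
  zeroW                         ∎
  where open ≡-Reasoning

RoutesBits : ∀ {w} → (Word w → Word w) → Set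
RoutesBits {w} f = ∀ k → k < w →
  (∀ x → testBit (f x) k ≡ false) ⊎ ∃ λ j → ∀ x → testBit (f x) k ≡ testBit x j

routesBits⇒xor-linear : ∀ {w} {f : Word w → Word w} → RoutesBits f → Xor-linear f
routesBits⇒xor-linear {f = f} routes x y = word-ext _ _ λ k k<w → bit k k<w (routes k k<w)
  where
  bit : ∀ k k<w → _ → testBit (f (x ⊕ y)) k ≡ testBit (f x ⊕ f y) k
  bit k _ (inj₁ cleared) rewrite testBit-⊕ (f x) (f y) k
    | cleared (x ⊕ y) | cleared x | cleared y = refl
  bit k _ (inj₂ (j , moved)) rewrite testBit-⊕ (f x) (f y) k
    | moved (x ⊕ y) | moved x | moved y = testBit-⊕ x y j

testBit-shl-low : ∀ {w} (x : Word w) a k → k < w → k < a → testBit (shl x a) k ≡ false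
testBit-shl-low {w} x a k k<w k<a = begin
  testBit (shl x a) k         ≡⟨ testBit-fromNat w _ k k<w ⟩
  testBitℕ (val x * 2 ^ a) k  ≡⟨ testBitℕ-low 0 (val x) a k k<a ⟩
  testBitℕ 0 k                ≡⟨ testBitℕ-0 k ⟩
  false                       ∎
  where open ≡-Reasoning

testBit-shl-high : ∀ {w} (x : Word w) a k → k < w → a ≤ k → testBit (shl x a) k ≡ testBit x (k ∸ a)
testBit-shl-high {w} x a k k<w a≤k = begin
  testBit (shl x a) k                 ≡⟨ testBit-fromNat w _ k k<w ⟩
  testBitℕ (val x * 2 ^ a) k          ≡⟨ cong (testBitℕ _) (m+[n∸m]≡n a≤k) ⟨
  testBitℕ (val x * 2 ^ a) (a + (k ∸ a)) ≡⟨ testBitℕ-high 0 (val x) a (k ∸ a) (m^n>0 2 a) ⟩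
  testBitℕ (val x) (k ∸ a)            ≡⟨ testBitℕ-val x (k ∸ a) ⟩
  testBit x (k ∸ a)                   ∎
  where open ≡-Reasoning

shl-routesBits : ∀ {w} a → RoutesBits {w} (λ x → shl x a)
shl-routesBits a k k<w with k <? a
... | yes k<a = inj₁ λ x → testBit-shl-low x a k k<w k<a
... | no  k≮a = inj₂ (k ∸ a , λ x → testBit-shl-high x a k k<w (≮⇒≥ k≮a))

module _ {w} (x : Word w) (b : ℕ) (b≤w : b ≤ w) where

  private
    wrapped = val x /2^ (w ∸ b)

    wrapped<2^b : wrapped < 2 ^ b
    wrapped<2^b = m<n*o⇒m/o<n {{m^n≢0 2 (w ∸ b)}} (subst (val x <_) 2^w-split (val<2^w x))
      where
      2^w-split : 2 ^ w ≡ 2 ^ b * 2 ^ (w ∸ b)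
      2^w-split = trans (cong (2 ^_) (sym (m+[n∸m]≡n b≤w))) (^-distribˡ-+-* 2 b (w ∸ b))

    testBit-rotl : ∀ k → k < w → testBit (rotl x b) k ≡ testBitℕ (wrapped + val x * 2 ^ b) k
    testBit-rotl k k<w =
      trans (testBit-fromNat w _ k k<w) (cong (λ n → testBitℕ n k) (+-comm (val x * 2 ^ b) wrapped))

  testBit-rotl-low : ∀ k → k < w → k < b → testBit (rotl x b) k ≡ testBit x (w ∸ b + k)
  testBit-rotl-low k k<w k<b = begin
    testBit (rotl x b) k                       ≡⟨ testBit-rotl k k<w ⟩
    testBitℕ (wrapped + val x * 2 ^ b) k       ≡⟨ testBitℕ-low wrapped (val x) b k k<b ⟩
    testBitℕ wrapped k                         ≡⟨ testBitℕ-/2^ (val x) (w ∸ b) k ⟩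
    testBitℕ (val x) (w ∸ b + k)               ≡⟨ testBitℕ-val x _ ⟩
    testBit x (w ∸ b + k)                      ∎
    where open ≡-Reasoning

  testBit-rotl-high : ∀ k → k < w → b ≤ k → testBit (rotl x b) k ≡ testBit x (k ∸ b)
  testBit-rotl-high k k<w b≤k = begin
    testBit (rotl x b) k
      ≡⟨ testBit-rotl k k<w ⟩
    testBitℕ (wrapped + val x * 2 ^ b) k
      ≡⟨ cong (testBitℕ _) (m+[n∸m]≡n b≤k) ⟨
    testBitℕ (wrapped + val x * 2 ^ b) (b + (k ∸ b))
      ≡⟨ testBitℕ-high wrapped (val x) b (k ∸ b) wrapped<2^b ⟩
    testBitℕ (val x) (k ∸ b)
      ≡⟨ testBitℕ-val x _ ⟩
    testBit x (k ∸ b) ∎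
    where open ≡-Reasoning

rotl-routesBits : ∀ {w} b → b ≤ w → RoutesBits {w} (λ x → rotl x b)
rotl-routesBits {w} b b≤w k k<w with k <? b
... | yes k<b = inj₂ (w ∸ b + k , λ x → testBit-rotl-low x b b≤w k k<w k<b)
... | no  k≮b = inj₂ (k ∸ b , λ x → testBit-rotl-high x b b≤w k k<w (≮⇒≥ k≮b))

shl-xor-linear : ∀ {w} a → Xor-linear {w} (λ x → shl x a)
shl-xor-linear a = routesBits⇒xor-linear (shl-routesBits a)

rotl-xor-linear : ∀ {w} b → b ≤ w → Xor-linear {w} (λ x → rotl x b)
rotl-xor-linear b b≤w = routesBits⇒xor-linear (rotl-routesBits b b≤w)

rotl-zeroW : ∀ {w} b → b ≤ w → rotl (zeroW {w}) b ≡ zeroW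
rotl-zeroW b b≤w = xor-linear⇒zero (rotl-xor-linear b b≤w)

rotl-inverse : ∀ {w} (x : Word w) b → b ≤ w → rotl (rotl x b) (w ∸ b) ≡ x
rotl-inverse {w} x b b≤w = word-ext _ _ λ k k<w → bit k k<w (k <? w ∸ b)
  where
  open ≡-Reasoning
  b' = w ∸ b
  w∸b'≡b : w ∸ b' ≡ b
  w∸b'≡b = m∸[m∸n]≡n b≤w
  b'≤w : b' ≤ w
  b'≤w = m∸n≤m w b
  bit : ∀ k → k < w → _ → testBit (rotl (rotl x b) b') k ≡ testBit x k
  bit k k<w (yes k<b') = begin
    testBit (rotl (rotl x b) b') k   ≡⟨ testBit-rotl-low (rotl x b) b' b'≤w k k<w k<b' ⟩
    testBit (rotl x b) (w ∸ b' + k)  ≡⟨ cong (λ i → testBit (rotl x b) (i + k)) w∸b'≡b ⟩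
    testBit (rotl x b) (b + k)       ≡⟨ testBit-rotl-high x b b≤w (b + k) b+k<w (m≤m+n b k) ⟩
    testBit x (b + k ∸ b)            ≡⟨ cong (testBit x) (m+n∸m≡n b k) ⟩
    testBit x k                      ∎
    where
    b+k<w : b + k < w
    b+k<w = subst (b + k <_) (m+[n∸m]≡n b≤w) (+-monoʳ-< b k<b')
  bit k k<w (no k≮b') = begin
    testBit (rotl (rotl x b) b') k
      ≡⟨ testBit-rotl-high (rotl x b) b' b'≤w k k<w (≮⇒≥ k≮b') ⟩
    testBit (rotl x b) (k ∸ b')
      ≡⟨ testBit-rotl-low x b b≤w (k ∸ b') (≤-<-trans (m∸n≤m k b') k<w) k∸b'<b ⟩
    testBit x (b' + (k ∸ b'))
      ≡⟨ cong (testBit x) (m+[n∸m]≡n (≮⇒≥ k≮b')) ⟩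
    testBit x k ∎
    where
    k∸b'<b : k ∸ b' < b
    k∸b'<b = subst (k ∸ b' <_) w∸b'≡b (∸-monoˡ-< k<w (≮⇒≥ k≮b'))

fromNat-+-multiple : ∀ w n q → fromNat w (n + q * 2 ^ w) ≡ fromNat w n
fromNat-+-multiple w n q = word-ext _ _ λ k k<w → begin
  testBit (fromNat w (n + q * 2 ^ w)) k  ≡⟨ testBit-fromNat w _ k k<w ⟩
  testBitℕ (n + q * 2 ^ w) k             ≡⟨ testBitℕ-low n q w k k<w ⟩
  testBitℕ n k                           ≡⟨ testBit-fromNat w n k k<w ⟨
  testBit (fromNat w n) k                ∎
  where open ≡-Reasoning

val-fromNat-split : ∀ w n → ∃ λ q → val (fromNat w n) + q * 2 ^ w ≡ n
val-fromNat-split zero    n = n , *-identityʳ n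
val-fromNat-split (suc w) n with val-fromNat-split w (n / 2)
... | q , split = q , (begin
  val (fromNat (suc w) n) + q * 2 ^ suc w    ≡⟨ cong (_+ q * 2 ^ suc w) (val-∷ low (fromNat w (n / 2))) ⟩
  bitValue low + 2 * v + q * (2 * 2 ^ w)     ≡⟨ regroup (bitValue low) v q (2 ^ w) ⟩
  bitValue low + (v + q * 2 ^ w) * 2         ≡⟨ cong₂ (λ l h → l + h * 2) (bitValue-%2 n) split ⟩
  n % 2 + n / 2 * 2                          ≡⟨ m≡m%n+[m/n]*n n 2 ⟨
  n                                          ∎)
  where
  open ≡-Reasoning
  low = n % 2 ≡ᵇ 1
  v   = val (fromNat w (n / 2))
  regroup : ∀ l v q p → l + 2 * v + q * (2 * p) ≡ l + (v + q * p) * 2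
  regroup = solve 4 (λ l v q p → l :+ con 2 :* v :+ q :* (con 2 :* p) := l :+ (v :+ q :* p) :* con 2)
                    refl
    where open +-*-Solver
  bitValue-%2 : ∀ n → bitValue (n % 2 ≡ᵇ 1) ≡ n % 2
  bitValue-%2 n with n % 2 | m%n<n n 2
  ... | 0 | _ = refl
  ... | 1 | _ = refl
  ... | suc (suc _) | s≤s (s≤s ())

fromNat-val-+ : ∀ w m n → fromNat w (val (fromNat w m) + n) ≡ fromNat w (m + n)
fromNat-val-+ w m n with val-fromNat-split w m
... | q , split = begin
  fromNat w (v + n)                  ≡⟨ fromNat-+-multiple w (v + n) q ⟨
  fromNat w (v + n + q * 2 ^ w)      ≡⟨ cong (fromNat w) (+-comm-middle v n (q * 2 ^ w)) ⟩
  fromNat w (v + q * 2 ^ w + n)      ≡⟨ cong (λ m → fromNat w (m + n)) split ⟩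
  fromNat w (m + n)                  ∎
  where
  open ≡-Reasoning
  v = val (fromNat w m)
  +-comm-middle : ∀ a b c → a + b + c ≡ a + c + b
  +-comm-middle a b c = trans (+-assoc a b c) (trans (cong (a +_) (+-comm b c)) (sym (+-assoc a c b)))

fromNat-val-+2^w : ∀ {w} (x : Word w) → fromNat w (val x + 2 ^ w) ≡ x
fromNat-val-+2^w {w} x = begin
  fromNat w (val x + 2 ^ w)      ≡⟨ cong (λ p → fromNat w (val x + p)) (*-identityˡ (2 ^ w)) ⟨
  fromNat w (val x + 1 * 2 ^ w)  ≡⟨ fromNat-+-multiple w (val x) 1 ⟩
  fromNat w (val x)              ≡⟨ fromNat-val x ⟩
  x                              ∎
  where open ≡-Reasoning

-- x ⊟ c is x − c in ℤ/2^wℤ; adding 2^w keeps the natural-number subtraction from truncating.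
_⊟_ : ∀ {w} → Word w → Word w → Word w
_⊟_ {w} x c = fromNat w (val x + (2 ^ w ∸ val c))

⊟-⊞-cancel : ∀ {w} (x c : Word w) → (x ⊟ c) ⊞ c ≡ x
⊟-⊞-cancel {w} x c = begin
  fromNat w (val (fromNat w (val x + (2 ^ w ∸ val c))) + val c)
    ≡⟨ fromNat-val-+ w _ (val c) ⟩
  fromNat w (val x + (2 ^ w ∸ val c) + val c)
    ≡⟨ cong (fromNat w) (+-assoc (val x) _ (val c)) ⟩
  fromNat w (val x + ((2 ^ w ∸ val c) + val c))
    ≡⟨ cong (λ p → fromNat w (val x + p)) (m∸n+n≡m (<⇒≤ (val<2^w c))) ⟩
  fromNat w (val x + 2 ^ w)
    ≡⟨ fromNat-val-+2^w x ⟩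
  x ∎
  where open ≡-Reasoning

⊞-⊟-cancel : ∀ {w} (x c : Word w) → (x ⊞ c) ⊟ c ≡ x
⊞-⊟-cancel {w} x c = begin
  fromNat w (val (fromNat w (val x + val c)) + (2 ^ w ∸ val c))
    ≡⟨ fromNat-val-+ w _ (2 ^ w ∸ val c) ⟩
  fromNat w (val x + val c + (2 ^ w ∸ val c))
    ≡⟨ cong (fromNat w) (+-assoc (val x) (val c) _) ⟩
  fromNat w (val x + (val c + (2 ^ w ∸ val c)))
    ≡⟨ cong (λ p → fromNat w (val x + p)) (m+[n∸m]≡n (<⇒≤ (val<2^w c))) ⟩
  fromNat w (val x + 2 ^ w)
    ≡⟨ fromNat-val-+2^w x ⟩
  x ∎
  where open ≡-Reasoning

⊞-comm : ∀ {w} (x y : Word w) → x ⊞ y ≡ y ⊞ x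
⊞-comm {w} x y = cong (fromNat w) (+-comm (val x) (val y))

zeroW-⊞-zeroW : ∀ {w} → zeroW ⊞ zeroW ≡ zeroW {w}
zeroW-⊞-zeroW {w} = trans (cong₂ (λ m n → fromNat w (m + n)) (val-zeroW w) (val-zeroW w)) (fromNat-0 w)

scramble : ∀ {w} → ℕ → Word w → Word w → Word w
scramble r c y = rotl (c ⊞ y) r ⊞ c

unscramble : ∀ {w} → ℕ → Word w → Word w → Word w
unscramble {w} r c o = rotl (o ⊟ c) (w ∸ r) ⊟ c

module _ {w r : ℕ} (r≤w : r ≤ w) (c : Word w) where

  scramble-unscramble : ∀ o → scramble r c (unscramble r c o) ≡ o
  scramble-unscramble o = begin
    rotl (c ⊞ (z ⊟ c)) r ⊞ c
      ≡⟨ cong (λ u → rotl u r ⊞ c) (trans (⊞-comm c (z ⊟ c)) (⊟-⊞-cancel z c)) ⟩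
    rotl z r ⊞ c
      ≡⟨ cong (λ i → rotl z i ⊞ c) (m∸[m∸n]≡n r≤w) ⟨
    rotl z (w ∸ (w ∸ r)) ⊞ c
      ≡⟨ cong (_⊞ c) (rotl-inverse (o ⊟ c) (w ∸ r) (m∸n≤m w r)) ⟩
    (o ⊟ c) ⊞ c
      ≡⟨ ⊟-⊞-cancel o c ⟩
    o ∎
    where
    open ≡-Reasoning
    z = rotl (o ⊟ c) (w ∸ r)

  unscramble-scramble : ∀ y → unscramble r c (scramble r c y) ≡ y
  unscramble-scramble y = begin
    rotl ((rotl (c ⊞ y) r ⊞ c) ⊟ c) (w ∸ r) ⊟ c
      ≡⟨ cong (λ u → rotl u (w ∸ r) ⊟ c) (⊞-⊟-cancel (rotl (c ⊞ y) r) c) ⟩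
    rotl (rotl (c ⊞ y) r) (w ∸ r) ⊟ c
      ≡⟨ cong (_⊟ c) (rotl-inverse (c ⊞ y) r r≤w) ⟩
    (c ⊞ y) ⊟ c
      ≡⟨ cong (_⊟ c) (⊞-comm c y) ⟩
    (y ⊞ c) ⊟ c
      ≡⟨ ⊞-⊟-cancel y c ⟩
    y ∎
    where open ≡-Reasoning

scramble-zeroW : ∀ {w r} → r ≤ w → scramble r zeroW zeroW ≡ zeroW {w}
scramble-zeroW {r = r} r≤w = begin
  rotl (zeroW ⊞ zeroW) r ⊞ zeroW   ≡⟨ cong (λ u → rotl u r ⊞ zeroW) zeroW-⊞-zeroW ⟩
  rotl zeroW r ⊞ zeroW             ≡⟨ cong (_⊞ zeroW) (rotl-zeroW r r≤w) ⟩
  zeroW ⊞ zeroW                    ≡⟨ zeroW-⊞-zeroW ⟩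
  zeroW                            ∎
  where open ≡-Reasoning

scrambleAll : ∀ {w n} → ℕ → Word w → Vec (Word w) n → Vec (Word w) n
scrambleAll r c []       = []
scrambleAll r c (y ∷ ys) = scramble r c y ∷ scrambleAll r (y ⊕ c) ys

unscrambleAll : ∀ {w n} → ℕ → Word w → Vec (Word w) n → Vec (Word w) n
unscrambleAll r c []       = []
unscrambleAll r c (o ∷ os) = let y = unscramble r c o in y ∷ unscrambleAll r (y ⊕ c) os

module _ {w r : ℕ} (r≤w : r ≤ w) where

  unscrambleAll-scrambleAll : ∀ {n} c (ys : Vec (Word w) n) → unscrambleAll r c (scrambleAll r c ys) ≡ ys
  unscrambleAll-scrambleAll c []       = refl
  unscrambleAll-scrambleAll c (y ∷ ys) rewrite unscramble-scramble r≤w c y =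
    cong (y ∷_) (unscrambleAll-scrambleAll (y ⊕ c) ys)

  scrambleAll-unscrambleAll : ∀ {n} c (os : Vec (Word w) n) → scrambleAll r c (unscrambleAll r c os) ≡ os
  scrambleAll-unscrambleAll c []       = refl
  scrambleAll-unscrambleAll c (o ∷ os) =
    cong₂ _∷_ (scramble-unscramble r≤w c o) (scrambleAll-unscrambleAll (unscramble r c o ⊕ c) os)

iterate-fixed : ∀ {A : Set} (f : A → A) {x} → f x ≡ x → ∀ k → iterate f k x ≡ x
iterate-fixed f fx≡x zero    = refl
iterate-fixed f fx≡x (suc k) = trans (cong f (iterate-fixed f fx≡x k)) fx≡x

iterate-∘-comm : ∀ {A : Set} (f : A → A) k x → iterate f k (f x) ≡ f (iterate f k x)
iterate-∘-comm f zero    x = refl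
iterate-∘-comm f (suc k) x = cong f (iterate-∘-comm f k x)

outTuple-suc : ∀ {k w} (T : State k w → State k w) (φ : State k w → Word w) d s →
               outTuple T φ (suc d) s ≡ φ s ∷ outTuple T φ d (T s)
outTuple-suc T φ d s = cong (φ s ∷_) (tabulate-cong λ i → cong φ (sym (iterate-∘-comm T (toℕ i) s)))

-- The ++ scrambler reads its carry from one state word (p₂) that is updated by xoring in the other
-- scrambled word (p₀), so the outputs and the initial carry determine the trajectory of p₀.
module ScrambledGenerator {k w r : ℕ} (r≤w : r ≤ w)
  (T : State k w → State k w) (φ p₀ p₂ : State k w → Word w)
  (scrambled : ∀ s → φ s ≡ scramble r (p₂ s) (p₀ s)) (carry : ∀ s → p₂ (T s) ≡ p₀ s ⊕ p₂ s) where

  outTuple-scrambled : ∀ d s → outTuple T φ d s ≡ scrambleAll r (p₂ s) (outTuple T p₀ d s)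
  outTuple-scrambled zero    s = refl
  outTuple-scrambled (suc d) s = begin
    outTuple T φ (suc d) s
      ≡⟨ outTuple-suc T φ d s ⟩
    φ s ∷ outTuple T φ d (T s)
      ≡⟨ cong₂ _∷_ (scrambled s) (outTuple-scrambled d (T s)) ⟩
    scramble r (p₂ s) (p₀ s) ∷ scrambleAll r (p₂ (T s)) (outTuple T p₀ d (T s))
      ≡⟨ cong (λ c → scramble r (p₂ s) (p₀ s) ∷ scrambleAll r c (outTuple T p₀ d (T s))) (carry s) ⟩
    scrambleAll r (p₂ s) (p₀ s ∷ outTuple T p₀ d (T s))
      ≡⟨ cong (scrambleAll r (p₂ s)) (outTuple-suc T p₀ d s) ⟨
    scrambleAll r (p₂ s) (outTuple T p₀ (suc d) s) ∎
    where open ≡-Reasoning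

  coordinates : ∀ d → State k w → Vec (Word w) (suc d)
  coordinates d s = p₂ s ∷ outTuple T p₀ d s

  outTuple-unscrambled : ∀ d s → outTuple T p₀ d s ≡ unscrambleAll r (p₂ s) (outTuple T φ d s)
  outTuple-unscrambled d s = begin
    outTuple T p₀ d s
      ≡⟨ unscrambleAll-scrambleAll r≤w (p₂ s) (outTuple T p₀ d s) ⟨
    unscrambleAll r (p₂ s) (scrambleAll r (p₂ s) (outTuple T p₀ d s))
      ≡⟨ cong (unscrambleAll r (p₂ s)) (outTuple-scrambled d s) ⟨
    unscrambleAll r (p₂ s) (outTuple T φ d s) ∎
    where open ≡-Reasoning

  module Fibres {d} (Φ : Vec (Word w) (suc d) → State k w)
    (Φ-coordinates : ∀ s → Φ (coordinates d s) ≡ s) (coordinates-Φ : ∀ v → coordinates d (Φ v) ≡ v) where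

    reconstruct : Vec (Word w) d → Word w → State k w
    reconstruct t c = Φ (c ∷ unscrambleAll r c t)

    fibre⇒reconstruct : ∀ t c s → outTuple T φ d s ≡ t × p₂ s ≡ c → s ≡ reconstruct t c
    fibre⇒reconstruct t c s (refl , refl) = begin
      s
        ≡⟨ Φ-coordinates s ⟨
      Φ (p₂ s ∷ outTuple T p₀ d s)
        ≡⟨ cong (λ ys → Φ (p₂ s ∷ ys)) (outTuple-unscrambled d s) ⟩
      Φ (p₂ s ∷ unscrambleAll r (p₂ s) (outTuple T φ d s)) ∎
      where open ≡-Reasoning

    reconstruct∈fibre : ∀ t c → outTuple T φ d (reconstruct t c) ≡ t × p₂ (reconstruct t c) ≡ c
    reconstruct∈fibre t c = outputs , cong head coordinates-s
      where
      s = reconstruct t c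
      coordinates-s : coordinates d s ≡ c ∷ unscrambleAll r c t
      coordinates-s = coordinates-Φ (c ∷ unscrambleAll r c t)
      outputs : outTuple T φ d s ≡ t
      outputs = begin
        outTuple T φ d s
          ≡⟨ outTuple-scrambled d s ⟩
        scrambleAll r (p₂ s) (outTuple T p₀ d s)
          ≡⟨ cong₂ (scrambleAll r) (cong head coordinates-s) (cong tail coordinates-s) ⟩
        scrambleAll r c (unscrambleAll r c t)
          ≡⟨ scrambleAll-unscrambleAll r≤w c t ⟩
        t ∎
        where open ≡-Reasoning

-- Formal xor-sums of operator strings applied to atoms: the free module on n generators over the
-- free algebra GF(2)⟨Op⟩. Equal monomials cancel on insertion, so identities between matrices can
-- be decided by normalisation (σ ≐ᴹ τ holds by refl) without ordering the monomials.
module FreeLinear (Op : Set) (_≟ₒ_ : DecidableEquality Op) where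

  Monomial : ℕ → Set
  Monomial n = List Op × Fin n

  Lin : ℕ → Set
  Lin n = List (Monomial n)

  Mat : ℕ → ℕ → Set
  Mat m n = Vec (Lin n) m

  private
    _≟ₘ_ : ∀ {n} → DecidableEquality (Monomial n)
    _≟ₘ_ = Product.≡-dec (List.≡-dec _≟ₒ_) Fin._≟_

  toggle : ∀ {n} → Monomial n → Lin n → Lin n
  toggle m []       = m ∷ []
  toggle m (m′ ∷ ℓ) with m ≟ₘ m′
  ... | yes _ = ℓ
  ... | no  _ = m′ ∷ toggle m ℓ

  infixl 6 _⊕ᴸ_
  _⊕ᴸ_ : ∀ {n} → Lin n → Lin n → Lin n
  ℓ ⊕ᴸ ℓ′ = foldr toggle ℓ′ ℓ

  atom : ∀ {n} → Fin n → Lin n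
  atom i = ([] , i) ∷ []

  infixr 7 _◃_ _◃*_
  _◃_ : ∀ {n} → Op → Lin n → Lin n
  o ◃ ℓ = mapᴸ (map₁ (o ∷_)) ℓ

  _◃*_ : ∀ {n} → List Op → Lin n → Lin n
  os ◃* ℓ = foldr _◃_ ℓ os

  _[_] : ∀ {n k} → Lin n → Mat n k → Lin k
  []             [ τ ] = []
  ((os , i) ∷ ℓ) [ τ ] = os ◃* lookup τ i ⊕ᴸ ℓ [ τ ]

  infixr 9 _∘ᴹ_
  _∘ᴹ_ : ∀ {m n k} → Mat m n → Mat n k → Mat m k
  σ ∘ᴹ τ = map _[ τ ] σ

  idᴹ : ∀ {n} → Mat n n
  idᴹ = tabulate atom

  infix 4 _≐ᴹ_
  _≐ᴹ_ : ∀ {m n} → Mat m n → Mat m n → Set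
  σ ≐ᴹ τ = zipWith _⊕ᴸ_ σ τ ≡ replicate _ []

  module Eval {w} (act : Op → Word w → Word w) (act-linear : ∀ o → Xor-linear (act o)) where

    ⟦_⟧ᵐ : ∀ {n} → Monomial n → Vec (Word w) n → Word w
    ⟦ os , i ⟧ᵐ v = foldr act (lookup v i) os

    ⟦_⟧ : ∀ {n} → Lin n → Vec (Word w) n → Word w
    ⟦ []    ⟧ v = zeroW
    ⟦ m ∷ ℓ ⟧ v = ⟦ m ⟧ᵐ v ⊕ ⟦ ℓ ⟧ v

    evalᴹ : ∀ {m n} → Mat m n → Vec (Word w) n → Vec (Word w) m
    evalᴹ σ v = map (λ ℓ → ⟦ ℓ ⟧ v) σ

    ⟦toggle⟧ : ∀ {n} m (ℓ : Lin n) v → ⟦ toggle m ℓ ⟧ v ≡ ⟦ m ⟧ᵐ v ⊕ ⟦ ℓ ⟧ v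
    ⟦toggle⟧ m []       v = refl
    ⟦toggle⟧ m (m′ ∷ ℓ) v with m ≟ₘ m′
    ... | yes refl = sym (⊕-cancelˡ (⟦ m ⟧ᵐ v) (⟦ ℓ ⟧ v))
    ... | no  _    =
      trans (cong (⟦ m′ ⟧ᵐ v ⊕_) (⟦toggle⟧ m ℓ v)) (⊕-swap (⟦ m′ ⟧ᵐ v) (⟦ m ⟧ᵐ v) (⟦ ℓ ⟧ v))

    ⟦⊕ᴸ⟧ : ∀ {n} (ℓ ℓ′ : Lin n) v → ⟦ ℓ ⊕ᴸ ℓ′ ⟧ v ≡ ⟦ ℓ ⟧ v ⊕ ⟦ ℓ′ ⟧ v
    ⟦⊕ᴸ⟧ []      ℓ′ v = sym (⊕-identityˡ (⟦ ℓ′ ⟧ v))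
    ⟦⊕ᴸ⟧ (m ∷ ℓ) ℓ′ v = begin
      ⟦ toggle m (ℓ ⊕ᴸ ℓ′) ⟧ v            ≡⟨ ⟦toggle⟧ m (ℓ ⊕ᴸ ℓ′) v ⟩
      ⟦ m ⟧ᵐ v ⊕ ⟦ ℓ ⊕ᴸ ℓ′ ⟧ v            ≡⟨ cong (⟦ m ⟧ᵐ v ⊕_) (⟦⊕ᴸ⟧ ℓ ℓ′ v) ⟩
      ⟦ m ⟧ᵐ v ⊕ (⟦ ℓ ⟧ v ⊕ ⟦ ℓ′ ⟧ v)     ≡⟨ ⊕-assoc (⟦ m ⟧ᵐ v) _ _ ⟨
      ⟦ m ⟧ᵐ v ⊕ ⟦ ℓ ⟧ v ⊕ ⟦ ℓ′ ⟧ v       ∎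
      where open ≡-Reasoning

    ⟦atom⟧ : ∀ {n} (i : Fin n) v → ⟦ atom i ⟧ v ≡ lookup v i
    ⟦atom⟧ i v = ⊕-identityʳ (lookup v i)

    ⟦◃⟧ : ∀ {n} o (ℓ : Lin n) v → ⟦ o ◃ ℓ ⟧ v ≡ act o (⟦ ℓ ⟧ v)
    ⟦◃⟧ o []      v = sym (xor-linear⇒zero (act-linear o))
    ⟦◃⟧ o (m ∷ ℓ) v =
      trans (cong (act o (⟦ m ⟧ᵐ v) ⊕_) (⟦◃⟧ o ℓ v)) (sym (act-linear o (⟦ m ⟧ᵐ v) (⟦ ℓ ⟧ v)))

    ⟦◃*⟧ : ∀ {n} os (ℓ : Lin n) v → ⟦ os ◃* ℓ ⟧ v ≡ foldr act (⟦ ℓ ⟧ v) os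
    ⟦◃*⟧ []       ℓ v = refl
    ⟦◃*⟧ (o ∷ os) ℓ v = trans (⟦◃⟧ o (os ◃* ℓ) v) (cong (act o) (⟦◃*⟧ os ℓ v))

    ⟦[]⟧ : ∀ {n k} (ℓ : Lin n) (τ : Mat n k) v → ⟦ ℓ [ τ ] ⟧ v ≡ ⟦ ℓ ⟧ (evalᴹ τ v)
    ⟦[]⟧ []             τ v = refl
    ⟦[]⟧ ((os , i) ∷ ℓ) τ v = begin
      ⟦ os ◃* lookup τ i ⊕ᴸ ℓ [ τ ] ⟧ v
        ≡⟨ ⟦⊕ᴸ⟧ (os ◃* lookup τ i) (ℓ [ τ ]) v ⟩
      ⟦ os ◃* lookup τ i ⟧ v ⊕ ⟦ ℓ [ τ ] ⟧ v
        ≡⟨ cong₂ _⊕_ (⟦◃*⟧ os (lookup τ i) v) (⟦[]⟧ ℓ τ v) ⟩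
      foldr act (⟦ lookup τ i ⟧ v) os ⊕ ⟦ ℓ ⟧ (evalᴹ τ v)
        ≡⟨ cong (λ x → foldr act x os ⊕ _) (lookup-map i _ τ) ⟨
      foldr act (lookup (evalᴹ τ v) i) os ⊕ ⟦ ℓ ⟧ (evalᴹ τ v) ∎
      where open ≡-Reasoning

    evalᴹ-∘ᴹ : ∀ {m n k} (σ : Mat m n) (τ : Mat n k) v → evalᴹ (σ ∘ᴹ τ) v ≡ evalᴹ σ (evalᴹ τ v)
    evalᴹ-∘ᴹ σ τ v = trans (sym (map-∘ _ _[ τ ] σ)) (map-cong (λ ℓ → ⟦[]⟧ ℓ τ v) σ)

    evalᴹ-idᴹ : ∀ {n} (v : Vec (Word w) n) → evalᴹ idᴹ v ≡ v
    evalᴹ-idᴹ v = begin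
      map (λ ℓ → ⟦ ℓ ⟧ v) (tabulate atom)   ≡⟨ tabulate-∘ _ atom ⟨
      tabulate (λ i → ⟦ atom i ⟧ v)        ≡⟨ tabulate-cong (λ i → ⟦atom⟧ i v) ⟩
      tabulate (lookup v)                  ≡⟨ tabulate∘lookup v ⟩
      v                                    ∎
      where open ≡-Reasoning

    ⟦⟧-zeros : ∀ {n} (ℓ : Lin n) → ⟦ ℓ ⟧ zeroV ≡ zeroW
    ⟦⟧-zeros []             = refl
    ⟦⟧-zeros ((os , i) ∷ ℓ) = begin
      foldr act (lookup zeroV i) os ⊕ ⟦ ℓ ⟧ zeroV
        ≡⟨ cong₂ (λ x z → foldr act x os ⊕ z) (lookup-replicate i zeroW) (⟦⟧-zeros ℓ) ⟩
      foldr act zeroW os ⊕ zeroW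
        ≡⟨ cong (_⊕ zeroW) (acts-zero os) ⟩
      zeroW ⊕ zeroW
        ≡⟨ ⊕-self zeroW ⟩
      zeroW ∎
      where
      open ≡-Reasoning
      acts-zero : ∀ os → foldr act zeroW os ≡ zeroW
      acts-zero []       = refl
      acts-zero (o ∷ os) = trans (cong (act o) (acts-zero os)) (xor-linear⇒zero (act-linear o))

    evalᴹ-zeros : ∀ {m n} (σ : Mat m n) → evalᴹ σ zeroV ≡ zeroV
    evalᴹ-zeros []      = refl
    evalᴹ-zeros (ℓ ∷ σ) = cong₂ _∷_ (⟦⟧-zeros ℓ) (evalᴹ-zeros σ)

    ≐ᴹ-sound : ∀ {m n} (σ τ : Mat m n) → σ ≐ᴹ τ → ∀ v → evalᴹ σ v ≡ evalᴹ τ v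
    ≐ᴹ-sound []      []       _       v = refl
    ≐ᴹ-sound (ℓ ∷ σ) (ℓ′ ∷ τ) cancels v =
      cong₂ _∷_ head-equal (≐ᴹ-sound σ τ (proj₂ (∷-injective cancels)) v)
      where
      head-equal : ⟦ ℓ ⟧ v ≡ ⟦ ℓ′ ⟧ v
      head-equal = ⊕≡zero⇒≡ _ _
        (trans (sym (⟦⊕ᴸ⟧ ℓ ℓ′ v)) (cong (λ ℓ″ → ⟦ ℓ″ ⟧ v) (proj₁ (∷-injective cancels))))

module _ {A : Set} where

  countWhere : {P : Pred A 0ℓ} → Decidable P → List A → ℕ
  countWhere P? xs = length (filter P? xs)

  -- Quantifying over every decider of a predicate equivalent to _≡ x lets each caller count with
  -- whatever decision procedure it has at hand.
  Enumerates : List A → Set₁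
  Enumerates xs = ∀ (x : A) {P : Pred A 0ℓ} (P? : Decidable P) → P ≐ (_≡ x) → countWhere P? xs ≡ 1

module _ {A : Set} {P : Pred A 0ℓ} where

  countWhere-∷ : ∀ (P? : Decidable P) x xs →
                 countWhere P? (x ∷ xs) ≡ bitValue (does (P? x)) + countWhere P? xs
  countWhere-∷ P? x xs with does (P? x)
  ... | false = refl
  ... | true  = refl

module _ {A : Set} {P : Pred A 0ℓ} (P? : Decidable P) where

  countWhere-none : (∀ x → ¬ P x) → ∀ xs → countWhere P? xs ≡ 0
  countWhere-none ¬P []       = refl
  countWhere-none ¬P (x ∷ xs) with P? x
  ... | yes p = ⊥-elim (¬P x p)
  ... | no  _ = countWhere-none ¬P xs

  countWhere-++ : ∀ xs ys → countWhere P? (xs ++ ys) ≡ countWhere P? xs + countWhere P? ys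
  countWhere-++ xs ys = trans (cong length (List.filter-++ P? xs ys)) (List.length-++ (filter P? xs))

  countWhere-map : ∀ {B : Set} (f : B → A) xs →
                   countWhere P? (mapᴸ f xs) ≡ countWhere (λ x → P? (f x)) xs
  countWhere-map f []       = refl
  countWhere-map f (x ∷ xs) = begin
    countWhere P? (f x ∷ mapᴸ f xs)
      ≡⟨ countWhere-∷ P? (f x) _ ⟩
    bitValue (does (P? (f x))) + countWhere P? (mapᴸ f xs) ≡⟨ cong (_ +_) (countWhere-map f xs) ⟩
    bitValue (does (P? (f x))) + countWhere (λ x → P? (f x)) xs
      ≡⟨ countWhere-∷ (λ x → P? (f x)) x xs ⟨
    countWhere (λ x → P? (f x)) (x ∷ xs) ∎
    where open ≡-Reasoning

  countWhere-concatMap : ∀ {B : Set} (f : B → List A) xs →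
                         countWhere P? (concatMap f xs) ≡ sum (mapᴸ (λ x → countWhere P? (f x)) xs)
  countWhere-concatMap f []       = refl
  countWhere-concatMap f (x ∷ xs) =
    trans (countWhere-++ (f x) (concatMap f xs)) (cong (countWhere P? (f x) +_) (countWhere-concatMap f xs))


module _ {B : Set} where

  sum-map-cong : ∀ {f g : B → ℕ} → (∀ y → f y ≡ g y) → ∀ ys → sum (mapᴸ f ys) ≡ sum (mapᴸ g ys)
  sum-map-cong f≗g ys = cong sum (List.map-cong f≗g ys)

  sum-map-+ : ∀ (f g : B → ℕ) ys → sum (mapᴸ (λ y → f y + g y) ys) ≡ sum (mapᴸ f ys) + sum (mapᴸ g ys)
  sum-map-+ f g []       = refl
  sum-map-+ f g (y ∷ ys) = trans (cong (f y + g y +_) (sum-map-+ f g ys)) (interchange (f y) (g y) _ _)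
    where
    interchange : ∀ a b c d → a + b + (c + d) ≡ a + c + (b + d)
    interchange = solve 4 (λ a b c d → a :+ b :+ (c :+ d) := a :+ c :+ (b :+ d)) refl
      where open +-*-Solver

  sum-map-0 : ∀ ys → sum (mapᴸ (λ (_ : B) → 0) ys) ≡ 0
  sum-map-0 []       = refl
  sum-map-0 (_ ∷ ys) = sum-map-0 ys

  sum-map-1 : ∀ ys → sum (mapᴸ (λ (_ : B) → 1) ys) ≡ length ys
  sum-map-1 []       = refl
  sum-map-1 (_ ∷ ys) = cong suc (sum-map-1 ys)

  sum-map-indicator : ∀ {P : Pred B 0ℓ} (P? : Decidable P) ys →
                      sum (mapᴸ (λ y → bitValue (does (P? y))) ys) ≡ countWhere P? ys
  sum-map-indicator P? []       = refl
  sum-map-indicator P? (y ∷ ys) =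
    trans (cong (_ +_) (sum-map-indicator P? ys)) (sym (countWhere-∷ P? y ys))

module _ {A B : Set} {P : Pred A 0ℓ} (P? : Decidable P) (h : A → B) (_≟_ : DecidableEquality B)
         (ys : List B) (ys-enum : Enumerates ys) where

  fibre? : (y : B) → Decidable (λ x → P x × h x ≡ y)
  fibre? y x = P? x ×-dec h x ≟ y

  countWhere-by-fibres : ∀ xs → countWhere P? xs ≡ sum (mapᴸ (λ y → countWhere (fibre? y) xs) ys)
  countWhere-by-fibres []       = sym (sum-map-0 ys)
  countWhere-by-fibres (x ∷ xs) = begin
    countWhere P? (x ∷ xs)
      ≡⟨ countWhere-∷ P? x xs ⟩
    bitValue (does (P? x)) + countWhere P? xs
      ≡⟨ cong₂ _+_ (sym (one-fibre (P? x))) (countWhere-by-fibres xs) ⟩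
    sum (mapᴸ (λ y → bitValue (does (fibre? y x))) ys)
      + sum (mapᴸ (λ y → countWhere (fibre? y) xs) ys)               ≡⟨ sum-map-+ _ _ ys ⟨
    sum (mapᴸ (λ y → bitValue (does (fibre? y x)) + countWhere (fibre? y) xs) ys)
      ≡⟨ sum-map-cong (λ y → sym (countWhere-∷ (fibre? y) x xs)) ys ⟩
    sum (mapᴸ (λ y → countWhere (fibre? y) (x ∷ xs)) ys) ∎
    where
    open ≡-Reasoning
    one-fibre : (Px? : Dec (P x)) →
                sum (mapᴸ (λ y → bitValue (does (Px? ×-dec h x ≟ y))) ys) ≡ bitValue (does Px?)
    one-fibre (yes _) =
      trans (sum-map-indicator (λ y → h x ≟ y) ys) (ys-enum (h x) (λ y → h x ≟ y) (sym , sym))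
    one-fibre (no  _) = sum-map-0 ys

  countWhere-fibres-singleton : ∀ xs → Enumerates xs → (g : B → A) →
    (∀ x y → P x × h x ≡ y → x ≡ g y) → (∀ y → P (g y) × h (g y) ≡ y) → countWhere P? xs ≡ length ys
  countWhere-fibres-singleton xs xs-enum g in-fibre⇒≡g fibre-of-g = begin
    countWhere P? xs                                      ≡⟨ countWhere-by-fibres xs ⟩
    sum (mapᴸ (λ y → countWhere (fibre? y) xs) ys)        ≡⟨ sum-map-cong singleton ys ⟩
    sum (mapᴸ (λ _ → 1) ys)                               ≡⟨ sum-map-1 ys ⟩
    length ys                                             ∎
    where
    open ≡-Reasoning
    singleton : ∀ y → countWhere (fibre? y) xs ≡ 1
    singleton y = xs-enum (g y) (fibre? y) (in-fibre⇒≡g _ y , λ { refl → fibre-of-g y })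

countWhere-bools : ∀ {P : Pred Bool 0ℓ} (P? : Decidable P) →
  countWhere P? (true ∷ false ∷ []) ≡ bitValue (does (P? true)) + bitValue (does (P? false))
countWhere-bools P? = begin
  countWhere P? (true ∷ false ∷ [])
    ≡⟨ countWhere-∷ P? true _ ⟩
  bitValue (does (P? true)) + countWhere P? (false ∷ [])
    ≡⟨ cong (bitValue (does (P? true)) +_) (countWhere-∷ P? false []) ⟩
  bitValue (does (P? true)) + (bitValue (does (P? false)) + 0)
    ≡⟨ cong (bitValue (does (P? true)) +_) (+-identityʳ _) ⟩
  bitValue (does (P? true)) + bitValue (does (P? false)) ∎
  where open ≡-Reasoning

countWhere-split : ∀ {A : Set} {Z P : Pred A 0ℓ} (Z? : Decidable Z) (P? : Decidable P) xs →
  countWhere (λ x → ¬? (Z? x) ×-dec P? x) xs + countWhere (λ x → Z? x ×-dec P? x) xs ≡ countWhere P? xs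
countWhere-split Z? P? []       = refl
countWhere-split Z? P? (x ∷ xs) = begin
  countWhere Z̸P? (x ∷ xs) + countWhere ZP? (x ∷ xs)
    ≡⟨ cong₂ _+_ (countWhere-∷ Z̸P? x xs) (countWhere-∷ ZP? x xs) ⟩
  (bitValue (does (Z̸P? x)) + countWhere Z̸P? xs)
    + (bitValue (does (ZP? x)) + countWhere ZP? xs)
    ≡⟨ interchange (bitValue (does (Z̸P? x))) (countWhere Z̸P? xs) _ _ ⟩
  (bitValue (does (Z̸P? x)) + bitValue (does (ZP? x)))
    + (countWhere Z̸P? xs + countWhere ZP? xs)
    ≡⟨ cong₂ _+_ (head-split (Z? x) (P? x)) (countWhere-split Z? P? xs) ⟩
  bitValue (does (P? x)) + countWhere P? xs
    ≡⟨ countWhere-∷ P? x xs ⟨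
  countWhere P? (x ∷ xs) ∎
  where
  open ≡-Reasoning
  Z̸P? = λ x → ¬? (Z? x) ×-dec P? x
  ZP? = λ x → Z? x ×-dec P? x
  interchange : ∀ a b c d → a + b + (c + d) ≡ a + c + (b + d)
  interchange = solve 4 (λ a b c d → a :+ b :+ (c :+ d) := a :+ c :+ (b :+ d)) refl
    where open +-*-Solver
  head-split : ∀ {Z P : Set} (z : Dec Z) (p : Dec P) →
               bitValue (does (¬? z ×-dec p)) + bitValue (does (z ×-dec p)) ≡ bitValue (does p)
  head-split (yes _) (yes _) = refl
  head-split (yes _) (no  _) = refl
  head-split (no  _) (yes _) = refl
  head-split (no  _) (no  _) = refl

module _ {A : Set} (_≟_ : DecidableEquality A) (xs : List A) (xs-enum : Enumerates xs) where

  countWhere-excluding : ∀ {P : Pred A 0ℓ} (P? : Decidable P) u →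
    let others = countWhere (λ x → ¬? (x ≟ u) ×-dec P? x) xs in
    (P u → others ≡ countWhere P? xs ∸ 1) × (¬ P u → others ≡ countWhere P? xs)
  countWhere-excluding {P} P? u = with-u , without-u
    where
    others = countWhere (λ x → ¬? (x ≟ u) ×-dec P? x) xs
    u∧P? = λ x → x ≟ u ×-dec P? x
    split : others + countWhere u∧P? xs ≡ countWhere P? xs
    split = countWhere-split (_≟ u) P? xs
    with-u : P u → others ≡ countWhere P? xs ∸ 1
    with-u Pu = begin
      others
        ≡⟨ m+n∸n≡m others 1 ⟨
      others + 1 ∸ 1
        ≡⟨ cong (λ n → others + n ∸ 1) (xs-enum u u∧P? (proj₁ , λ { refl → refl , Pu })) ⟨
      others + countWhere u∧P? xs ∸ 1
        ≡⟨ cong (_∸ 1) split ⟩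
      countWhere P? xs ∸ 1 ∎
      where open ≡-Reasoning
    without-u : ¬ P u → others ≡ countWhere P? xs
    without-u ¬Pu = begin
      others
        ≡⟨ +-identityʳ others ⟨
      others + 0
        ≡⟨ cong (others +_) (countWhere-none u∧P? (λ { _ (refl , Pu) → ¬Pu Pu }) xs) ⟨
      others + countWhere u∧P? xs
        ≡⟨ split ⟩
      countWhere P? xs ∎
      where open ≡-Reasoning

module _ {A : Set} (_≟_ : DecidableEquality A) (xs : List A) (xs-enum : Enumerates xs) where

  allVecs-enumerates : ∀ n → Enumerates (allVecs xs n)
  allVecs-enumerates zero    [] P? P≐[] =
    trans (countWhere-∷ P? [] []) (cong (λ b → bitValue b + 0) (dec-true (P? []) (proj₂ P≐[] refl)))
  allVecs-enumerates (suc n) (x ∷ v) {P} P? P≐x∷v = begin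
    countWhere P? (concatMap (λ y → mapᴸ (y ∷_) (allVecs xs n)) xs)
      ≡⟨ countWhere-concatMap P? _ xs ⟩
    sum (mapᴸ (λ y → countWhere P? (mapᴸ (y ∷_) (allVecs xs n))) xs)
      ≡⟨ sum-map-cong (λ y → trans (countWhere-map P? (y ∷_) (allVecs xs n)) (tails y (y ≟ x))) xs ⟩
    sum (mapᴸ (λ y → bitValue (does (y ≟ x))) xs)
      ≡⟨ sum-map-indicator (_≟ x) xs ⟩
    countWhere (_≟ x) xs
      ≡⟨ xs-enum x (_≟ x) ((λ p → p) , (λ p → p)) ⟩
    1 ∎
    where
    open ≡-Reasoning
    tails : ∀ y (y≟x : Dec (y ≡ x)) → countWhere (λ z → P? (y ∷ z)) (allVecs xs n) ≡ bitValue (does y≟x)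
    tails y (yes refl) = allVecs-enumerates n v (λ z → P? (x ∷ z))
      ((λ p → proj₂ (∷-injective (proj₁ P≐x∷v p))) , λ { refl → proj₂ P≐x∷v refl })
    tails y (no y≢x)   =
      countWhere-none (λ z → P? (y ∷ z)) (λ z p → y≢x (proj₁ (∷-injective (proj₁ P≐x∷v p)))) (allVecs xs n)

bool-enumeration : Enumerates (true ∷ false ∷ [])
bool-enumeration true  P? P≐true  = trans (countWhere-bools P?)
  (cong₂ (λ p q → bitValue p + bitValue q)
         (dec-true (P? true) (proj₂ P≐true refl)) (dec-false (P? false) (λ p → case proj₁ P≐true p of λ ())))
bool-enumeration false P? P≐false = trans (countWhere-bools P?)
  (cong₂ (λ p q → bitValue p + bitValue q)
         (dec-false (P? true) (λ p → case proj₁ P≐false p of λ ())) (dec-true (P? false) (proj₂ P≐false refl)))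

length-allVecs : ∀ {A : Set} (xs : List A) n → length (allVecs xs n) ≡ length xs ^ n
length-allVecs xs zero    = refl
length-allVecs xs (suc n) = trans (prepend-all xs) (cong (length xs *_) (length-allVecs xs n))
  where
  prepend-all : ∀ ys →
    length (concatMap (λ y → mapᴸ (y ∷_) (allVecs xs n)) ys) ≡ length ys * length (allVecs xs n)
  prepend-all []       = refl
  prepend-all (y ∷ ys) = begin
    length (mapᴸ (y ∷_) V ++ concatMap (λ y → mapᴸ (y ∷_) V) ys)
      ≡⟨ List.length-++ (mapᴸ (y ∷_) V) ⟩
    length (mapᴸ (y ∷_) V) + length (concatMap (λ y → mapᴸ (y ∷_) V) ys)
      ≡⟨ cong₂ _+_ (List.length-map (y ∷_) V) (prepend-all ys) ⟩
    length V + length ys * length V ∎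
    where
    open ≡-Reasoning
    V = allVecs xs n

data XorshiftOp : Set where
  shift rotate : XorshiftOp

_≟op_ : DecidableEquality XorshiftOp
shift  ≟op shift  = yes refl
shift  ≟op rotate = no λ ()
rotate ≟op shift  = no λ ()
rotate ≟op rotate = yes refl

open FreeLinear XorshiftOp _≟op_

var : ∀ i {i<8 : True (i Data.Nat.<? 8)} → Lin 8
var i {i<8} = atom (#_ i {m<n = i<8})

Next : Mat 8 8
Next = var 0 ⊕ᴸ var 6
     ∷ var 0 ⊕ᴸ var 1 ⊕ᴸ var 2
     ∷ var 0 ⊕ᴸ var 2
     ∷ var 3 ⊕ᴸ var 4
     ∷ var 1 ⊕ᴸ var 4 ⊕ᴸ var 5
     ∷ var 1 ⊕ᴸ var 5
     ∷ var 3 ⊕ᴸ var 6 ⊕ᴸ var 7 ⊕ᴸ shift ◃ var 1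
     ∷ rotate ◃ (var 3 ⊕ᴸ var 7)
     ∷ []

Coordinates : Mat 8 8
Coordinates = var 2 ∷ tabulate (λ k → lookup (iterate (Next ∘ᴹ_) (toℕ k) idᴹ) zero)

-- The inverse of Coordinates, obtained by running the recurrences of next backwards. Atom 0 is
-- c = s₂ and atom k + 1 is y k, the value of s₀ after k steps (y k for k ≥ 7 is junk, never used).
-- At time t, s2At t and s6At t are s₂ and s₆, s1Drift t is s₁(t) ⊕ s₁(0),
-- e t = s₆(t+1) ⊕ s₆(t) = u(t) ⊕ (s₁(t) ≪ a) with u = s₃ ⊕ s₇, and h t = u(0) ⊕ u(t); the remaining
-- words are then solved from h 1 … h 4 using u(t+1) = s₃(t) ⊕ s₄(t) ⊕ rotl(u(t), b).
module InverseFormulas where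
  c : Lin 8
  c = atom zero

  y : ℕ → Lin 8
  y k with suc k Data.Nat.<? 8
  ... | yes k+1<8 = atom (fromℕ< k+1<8)
  ... | no  _     = []

  s2At : ℕ → Lin 8
  s2At zero    = c
  s2At (suc k) = y k ⊕ᴸ s2At k

  s6At : ℕ → Lin 8
  s6At k = y k ⊕ᴸ y (suc k)

  s1Drift : ℕ → Lin 8
  s1Drift zero    = []
  s1Drift (suc t) = s1Drift t ⊕ᴸ (y t ⊕ᴸ s2At t)

  e : ℕ → Lin 8
  e t = s6At (suc t) ⊕ᴸ s6At t

  h : ℕ → Lin 8
  h t = e 0 ⊕ᴸ e t ⊕ᴸ shift ◃ s1Drift t

  R² R³ : Lin 8 → Lin 8
  R² ℓ = rotate ◃ rotate ◃ ℓ
  R³ ℓ = rotate ◃ R² ℓ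

  p₂ p₃ p₄ s₁ s₃⊕s₇ s₄ s₅ s₇ : Lin 8
  p₂ = h 2 ⊕ᴸ h 1 ⊕ᴸ rotate ◃ h 1
  p₃ = h 3 ⊕ᴸ h 1 ⊕ᴸ rotate ◃ h 1 ⊕ᴸ R² (h 1)
  p₄ = h 4 ⊕ᴸ h 1 ⊕ᴸ rotate ◃ h 1 ⊕ᴸ R² (h 1) ⊕ᴸ R³ (h 1)
  s₅ = p₃ ⊕ᴸ rotate ◃ p₂ ⊕ᴸ y 0 ⊕ᴸ c
  s₄ = p₄ ⊕ᴸ R² p₂ ⊕ᴸ rotate ◃ s₅ ⊕ᴸ rotate ◃ (y 0 ⊕ᴸ c) ⊕ᴸ c ⊕ᴸ y 0 ⊕ᴸ y 1
  s₁ = p₂ ⊕ᴸ s₅ ⊕ᴸ s₄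
  s₃⊕s₇ = e 0 ⊕ᴸ shift ◃ s₁
  s₇ = h 1 ⊕ᴸ rotate ◃ s₃⊕s₇ ⊕ᴸ s₄

-- Opaque, so that the large matrix is unfolded only by the two normalisation checks below.
opaque
  Inverse : Mat 8 8
  Inverse = y 0 ∷ s₁ ∷ c ∷ s₃⊕s₇ ⊕ᴸ s₇ ∷ s₄ ∷ s₅ ∷ y 0 ⊕ᴸ y 1 ∷ s₇ ∷ []
    where open InverseFormulas

  Inverse-∘-Coordinates : Inverse ∘ᴹ Coordinates ≐ᴹ idᴹ
  Inverse-∘-Coordinates = refl

  Coordinates-∘-Inverse : Coordinates ∘ᴹ Inverse ≐ᴹ idᴹ
  Coordinates-∘-Inverse = refl

word₀ word₂ : ∀ {w} → State 8 w → Word w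
word₀ s = lookup s zero
word₂ s = lookup s (suc (suc zero))

module Xoshiro (w a b r : ℕ) (b≤w : b ≤ w) (r≤w : r ≤ w) where

  act : XorshiftOp → Word w → Word w
  act shift  x = shl x a
  act rotate x = rotl x b

  act-linear : ∀ o → Xor-linear (act o)
  act-linear shift  = shl-xor-linear a
  act-linear rotate = rotl-xor-linear b b≤w

  open Eval act act-linear

  T : State 8 w → State 8 w
  T = next w a b

  next-evalᴹ : ∀ s → T s ≡ evalᴹ Next s
  next-evalᴹ s@(x₀ ∷ x₁ ∷ x₂ ∷ x₃ ∷ x₄ ∷ x₅ ∷ x₆ ∷ x₇ ∷ []) = sym
    (cong₂ _∷_ (⟦⊕⟧² (# 0) (# 6)) (cong₂ _∷_ (⟦⊕⟧³ (# 0) (# 1) (# 2)) (cong₂ _∷_ (⟦⊕⟧² (# 0) (# 2))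
    (cong₂ _∷_ (⟦⊕⟧² (# 3) (# 4)) (cong₂ _∷_ (⟦⊕⟧³ (# 1) (# 4) (# 5)) (cong₂ _∷_ (⟦⊕⟧² (# 1) (# 5))
    (cong₂ _∷_ component₆ (cong₂ _∷_ component₇ refl))))))))
    where
    ⟦⊕⟧² : ∀ i j → ⟦ atom i ⊕ᴸ atom j ⟧ s ≡ lookup s i ⊕ lookup s j
    ⟦⊕⟧² i j = trans (⟦⊕ᴸ⟧ (atom i) (atom j) s) (cong₂ _⊕_ (⟦atom⟧ i s) (⟦atom⟧ j s))
    ⟦⊕⟧³ : ∀ i j k → ⟦ atom i ⊕ᴸ atom j ⊕ᴸ atom k ⟧ s ≡ lookup s i ⊕ lookup s j ⊕ lookup s k
    ⟦⊕⟧³ i j k = trans (⟦⊕ᴸ⟧ (atom i ⊕ᴸ atom j) (atom k) s) (cong₂ _⊕_ (⟦⊕⟧² i j) (⟦atom⟧ k s))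
    component₆ : ⟦ var 3 ⊕ᴸ var 6 ⊕ᴸ var 7 ⊕ᴸ shift ◃ var 1 ⟧ s ≡ x₃ ⊕ x₆ ⊕ x₇ ⊕ shl x₁ a
    component₆ = trans (⟦⊕ᴸ⟧ (var 3 ⊕ᴸ var 6 ⊕ᴸ var 7) (shift ◃ var 1) s)
      (cong₂ _⊕_ (⟦⊕⟧³ (# 3) (# 6) (# 7))
                 (trans (⟦◃⟧ shift (var 1) s) (cong (act shift) (⟦atom⟧ (# 1) s))))
    component₇ : ⟦ rotate ◃ (var 3 ⊕ᴸ var 7) ⟧ s ≡ rotl (x₃ ⊕ x₇) b
    component₇ = trans (⟦◃⟧ rotate (var 3 ⊕ᴸ var 7) s) (cong (act rotate) (⟦⊕⟧² (# 3) (# 7)))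

  φ : State 8 w → Word w
  φ = output w r

  scrambled : ∀ s → φ s ≡ scramble r (word₂ s) (word₀ s)
  scrambled (_ ∷ _ ∷ _ ∷ _ ∷ _ ∷ _ ∷ _ ∷ _ ∷ []) = refl

  carry : ∀ s → word₂ (T s) ≡ word₀ s ⊕ word₂ s
  carry (_ ∷ _ ∷ _ ∷ _ ∷ _ ∷ _ ∷ _ ∷ _ ∷ []) = refl

  open ScrambledGenerator r≤w T φ word₀ word₂ scrambled carry

  iterate-evalᴹ : ∀ k s → iterate T k s ≡ evalᴹ (iterate (Next ∘ᴹ_) k idᴹ) s
  iterate-evalᴹ zero    s = sym (evalᴹ-idᴹ s)
  iterate-evalᴹ (suc k) s = begin
    T (iterate T k s)                 ≡⟨ cong T (iterate-evalᴹ k s) ⟩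
    T (evalᴹ P s)                     ≡⟨ next-evalᴹ (evalᴹ P s) ⟩
    evalᴹ Next (evalᴹ P s)            ≡⟨ evalᴹ-∘ᴹ Next P s ⟨
    evalᴹ (Next ∘ᴹ P) s               ∎
    where
    open ≡-Reasoning
    P = iterate (Next ∘ᴹ_) k idᴹ

  coordinates-evalᴹ : ∀ s → coordinates 7 s ≡ evalᴹ Coordinates s
  coordinates-evalᴹ s =
    cong₂ _∷_ (sym (⟦atom⟧ (# 2) s)) (trans (tabulate-cong trajectory) (tabulate-∘ (λ ℓ → ⟦ ℓ ⟧ s) row₀))
    where
    row₀ : Fin 7 → Lin 8
    row₀ k = lookup (iterate (Next ∘ᴹ_) (toℕ k) idᴹ) zero
    trajectory : ∀ k → word₀ (iterate T (toℕ k) s) ≡ ⟦ row₀ k ⟧ s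
    trajectory k = trans (cong word₀ (iterate-evalᴹ (toℕ k) s))
                         (lookup-map zero (λ ℓ → ⟦ ℓ ⟧ s) (iterate (Next ∘ᴹ_) (toℕ k) idᴹ))

  inverse-coordinates : ∀ s → evalᴹ Inverse (coordinates 7 s) ≡ s
  inverse-coordinates s = begin
    evalᴹ Inverse (coordinates 7 s)
      ≡⟨ cong (evalᴹ Inverse) (coordinates-evalᴹ s) ⟩
    evalᴹ Inverse (evalᴹ Coordinates s)
      ≡⟨ evalᴹ-∘ᴹ Inverse Coordinates s ⟨
    evalᴹ (Inverse ∘ᴹ Coordinates) s
      ≡⟨ ≐ᴹ-sound (Inverse ∘ᴹ Coordinates) idᴹ Inverse-∘-Coordinates s ⟩
    evalᴹ idᴹ s
      ≡⟨ evalᴹ-idᴹ s ⟩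
    s ∎
    where open ≡-Reasoning

  coordinates-inverse : ∀ v → coordinates 7 (evalᴹ Inverse v) ≡ v
  coordinates-inverse v = begin
    coordinates 7 (evalᴹ Inverse v)
      ≡⟨ coordinates-evalᴹ (evalᴹ Inverse v) ⟩
    evalᴹ Coordinates (evalᴹ Inverse v)
      ≡⟨ evalᴹ-∘ᴹ Coordinates Inverse v ⟨
    evalᴹ (Coordinates ∘ᴹ Inverse) v
      ≡⟨ ≐ᴹ-sound (Coordinates ∘ᴹ Inverse) idᴹ Coordinates-∘-Inverse v ⟩
    evalᴹ idᴹ v
      ≡⟨ evalᴹ-idᴹ v ⟩
    v ∎
    where open ≡-Reasoning

  open Fibres (evalᴹ Inverse) inverse-coordinates coordinates-inverse

  outTuple-zeroV : outTuple T φ 7 zeroV ≡ zeroV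
  outTuple-zeroV =
    tabulate-cong λ k → trans (cong φ (iterate-fixed T T-zeroV (toℕ k))) (scramble-zeroW r≤w)
    where
    T-zeroV : T zeroV ≡ zeroV
    T-zeroV = trans (next-evalᴹ zeroV) (evalᴹ-zeros Next)

  outputs? : (t : Vec (Word w) 7) → Decidable (λ s → outTuple T φ 7 s ≡ t)
  outputs? t s = outTuple T φ 7 s ≟V t

  words-enumeration : Enumerates (allWords w)
  words-enumeration = allVecs-enumerates Data.Bool._≟_ (true ∷ false ∷ []) bool-enumeration w

  states-enumeration : Enumerates (allStates 8 w)
  states-enumeration = allVecs-enumerates _≟W_ (allWords w) words-enumeration 8

  count-outputs : ∀ t → countWhere (outputs? t) (allStates 8 w) ≡ 2 ^ (w * (8 ∸ 7))
  count-outputs t = begin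
    countWhere (outputs? t) (allStates 8 w)
      ≡⟨ countWhere-fibres-singleton (outputs? t) word₂ _≟W_ (allWords w) words-enumeration (allStates 8 w)
           states-enumeration (reconstruct t) (λ s c → fibre⇒reconstruct t c s) (reconstruct∈fibre t) ⟩
    length (allWords w)
      ≡⟨ length-allVecs (true ∷ false ∷ []) w ⟩
    2 ^ w
      ≡⟨ cong (2 ^_) (*-identityʳ w) ⟨
    2 ^ (w * (8 ∸ 7)) ∎
    where open ≡-Reasoning

  equidistributed : Equidistributed 8 w T φ 7
  equidistributed t =
    (λ t≡0 → trans (proj₁ excluding-zero (trans outTuple-zeroV (sym t≡0)))
                   (cong (_∸ 1) (count-outputs t))) ,
    (λ t≢0 → trans (proj₂ excluding-zero λ zero↦t → t≢0 (trans (sym zero↦t) outTuple-zeroV))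
                   (count-outputs t))
    where
    excluding-zero = countWhere-excluding _≟V_ (allStates 8 w) states-enumeration (outputs? t) zeroV

mainTheorem5 : (w : ℕ) → 1 ≤ w → (a b r : ℕ) → a < w → b < w → r < w →
    Equidistributed 8 w (next w a b) (output w r) 7
mainTheorem5 w _ a b r _ b<w r<w = Xoshiro.equidistributed w a b r (<⇒≤ b<w) (<⇒≤ r<w)
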